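{- Let $m$ be a positive even integer. Let $A, B\subseteq \mathbb{Z}_{m}$ with $A\cup B=\mathbb{Z}_{m}$ and $A\cap B=\{\overline{r_{1}}, \overline{r_{2}}\}$ (with $\overline{r_1}\neq\overline{r_2}$). If $R_{A}(\overline{n})=R_{B}(\overline{n})$ for all $\overline{n}\in \mathbb{Z}_{m}$, then for every integer $n$: $$\chi_{A}(n-r_{1})+\chi_{A}(n-r_{2})=1+R_{\{\overline{r_{1}}, \overline{r_{2}}\}}(\overline{n}) \quad \text{if } 2\nmid n,$$ and $$\chi_{A}(n-r_{1})+\chi_{A}(n-r_{2})=2+R_{\{\overline{r_{1}}, \overline{r_{2}}\}}(\overline{n})-\chi_{A}\!\left(\tfrac{n}{2}\right)-\chi_{A}\!\left(\tfrac{n+m}{2}\right) \quad \text{if } 2\mid n.$$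
   Context: $\mathbb{Z}_{m}$ is the set of residue classes modulo $m$. For $\overline{a},\overline{b}\in\mathbb{Z}_m$, write $\overline{a}\leq\overline{b}$ if $a'\le b'$, where $a',b'\in\{0,1,\dots,m-1\}$ are the representatives of $\overline{a},\overline{b}$. For $S\subseteq\mathbb{Z}_m$ and $\overline{n}\in\mathbb{Z}_m$, $R_S(\overline{n})$ denotes the number of solutions of $\overline{n}=\overline{a}+\overline{a'}$ with $\overline{a}\leq\overline{a'}$ and $\overline{a},\overline{a'}\in S$. For $A\subseteq\mathbb{Z}_m$ and an integer $n$, the characteristic function is $\chi_A(n)=1$ if $\overline{n}\in A$ and $\chi_A(n)=0$ otherwise. -}

module Defs where

open import Data.Nat as ℕ using (ℕ; NonZero)
open import Data.Integer as ℤ using (ℤ)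
open import Data.Integer.DivMod using (_%ℕ_; n%ℕd<d)
open import Data.Fin using (Fin; toℕ; fromℕ<)
open import Data.Fin.Subset using (Subset; _∈_)
open import Data.Fin.Subset.Properties using (_∈?_)
open import Data.List using (List; length; filter; allFin; cartesianProduct)
open import Data.Product using (_×_; _,_)
open import Relation.Nullary using (Dec; yes; no; _×-dec_)

-- ℤ_m is represented by Fin m; the residue class of i : Fin m has
-- representative toℕ i ∈ {0,…,m-1}.

res : (m : ℕ) .{{_ : NonZero m}} → ℤ → Fin m
res m n = fromℕ< (n%ℕd<d n m)

_≤ᶻ_ : ∀ {m} → Fin m → Fin m → Set
a ≤ᶻ b = toℕ a ℕ.≤ toℕ b

R : (m : ℕ) .{{_ : NonZero m}} → Subset m → Fin m → ℕ
R m S n = length (filter P? (cartesianProduct (allFin m) (allFin m)))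
  where
  P : Fin m × Fin m → Set
  P (a , a') = (a ∈ S × a' ∈ S) × ((a ≤ᶻ a') × ((toℕ a ℕ.+ toℕ a') ℕ.% m ≡ toℕ n))
    where open import Relation.Binary.PropositionalEquality using (_≡_)
  P? : (x : Fin m × Fin m) → Dec (P x)
  P? (a , a') = ((a ∈? S) ×-dec (a' ∈? S)) ×-dec
                ((toℕ a ℕ.≤? toℕ a') ×-dec (((toℕ a ℕ.+ toℕ a') ℕ.% m) ℕ.≟ toℕ n))

χ : (m : ℕ) .{{_ : NonZero m}} → Subset m → ℤ → ℕ
χ m A n with res m n ∈? A
... | yes _ = 1
... | no  _ = 0

{-# OPTIONS --safe #-}
-- Let x, y, c be the indicator functions of A, B and C = {r₁, r₂}; the hypotheses
-- on A and B say x + y = 1 + c pointwise.  For u, v : ℤ_m → ℕ put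
-- (u ⋆ v)(n) = Σ_{a+b=n} u(a) v(b).  Counting ordered pairs twice,
-- 2 R_S(n) = (1_S ⋆ 1_S)(n) + D_S(n), where D_S(n) counts the a ∈ S with 2a = n;
-- summing over n gives |S|² + |S|, so R_A = R_B forces |A| = |B| = (m + 2)/2.
-- Substituting y = 1 + c − x into y ⋆ y yields
-- (y ⋆ y)(n) + 2 T(n) = (x ⋆ x)(n) + 2 + (c ⋆ c)(n), with T(n) = (c ⋆ x)(n) =
-- χ_A(n − r₁) + χ_A(n − r₂).  Eliminating the convolutions with the first identity
-- leaves 2 (T(n) + D_A(n)) = 2 + D(n) + 2 R_C(n), D(n) being the number of solutions
-- of 2a = n.  For odd n there are none; for n = 2k they are k and k + m/2.

module Submission where

open import Data.Bool.Base using (true; false; if_then_else_)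
open import Data.Fin.Base using (Fin; zero; suc; toℕ; punchIn; punchOut)
open import Data.Fin.Properties using (punchInᵢ≢i; punchIn-injective; punchIn-punchOut)
open import Data.List.Base using (List; _++_; length; filter; map; tabulate; cartesianProduct)
open import Data.List.Properties using (filter-++; length-++; map-tabulate)
open import Data.Nat as ℕ using (ℕ; zero; suc; _+_; _*_; _<_; _≤_; NonZero)
open import Data.Nat.Divisibility as ℕ∣ using (_∣_; >⇒∤)
open import Data.Nat.Properties as ℕP using (+-*-semiring)
open import Data.Nat.Tactic.RingSolver using (solve-∀)
open import Data.Product.Base using (_×_; _,_; proj₁; proj₂)
open import Data.Sum.Base as Sum using (_⊎_; inj₁; inj₂)
open import Function.Base using (_∘_; id)
open import Relation.Binary.Definitions using (tri<; tri≈; tri>)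
open import Relation.Binary.PropositionalEquality
open import Relation.Nullary.Decidable using (Dec; yes; no; does; dec-true; dec-false)
open import Relation.Nullary.Decidable.Core using (_×-dec_)
open import Relation.Nullary.Negation using (¬_; contradiction)
open import Relation.Unary using (Pred; Decidable)

open import Data.Fin.Subset using (Subset; ⊤; _∪_; _∩_; ⁅_⁆; _∈_)
open import Data.Fin.Subset.Properties
  using (_∈?_; ∈⊤; x∈⁅x⁆; x∈⁅y⁆⇒x≡y; x∈p∩q⁺; x∈p∩q⁻; x∈p∪q⁺; x∈p∪q⁻)
open import Data.Fin.Properties using (toℕ-injective; toℕ-fromℕ<; toℕ<n)
open import Data.Integer.Base as ℤ using (ℤ; +_; _-_)
import Data.Integer.Properties as ℤP
open import Data.Integer.DivMod using (_%ℕ_; _/ℕ_; n%ℕd<d; a≡a%ℕn+[a/ℕn]*n)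
open import Data.Integer.Divisibility.Signed
  using (divides; quotient; ∣⇒∣ᵤ; ∣ᵤ⇒∣; ∣-trans; ∣m∣n⇒∣m+n; ∣m∣n⇒∣m-n; *-cancelˡ-∣)
  renaming (_∣_ to _∣ₛ_)
open import Data.Integer.Divisibility using () renaming (_∣_ to _∣ℤ_)
open import Data.Integer.Tactic.RingSolver using () renaming (solve-∀ to ℤ-solve-∀)
open import Data.Nat.DivMod using (m<n⇒m%n≡m)
open import Defs

open import Algebra.Properties.Semiring.Sum +-*-semiring
  using (sum; sum-syntax; sum-cong-≗; sum-remove; sum-replicate-zero; ∑-comm; ∑-distrib-+; *-distribˡ-sum; *-distribʳ-sum)

𝟙 : ∀ {p} {P : Set p} → Dec P → ℕ
𝟙 d = if does d then 1 else 0

module _ {p} {P : Set p} where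

  𝟙-yes : (d : Dec P) → P → 𝟙 d ≡ 1
  𝟙-yes d x rewrite dec-true d x = refl

  𝟙-no : (d : Dec P) → ¬ P → 𝟙 d ≡ 0
  𝟙-no d ¬x rewrite dec-false d ¬x = refl

  𝟙-idem : (d : Dec P) → 𝟙 d * 𝟙 d ≡ 𝟙 d
  𝟙-idem d with does d
  ... | true  = refl
  ... | false = refl

𝟙-×-dec : ∀ {p q} {P : Set p} {Q : Set q} (d : Dec P) (e : Dec Q) → 𝟙 (d ×-dec e) ≡ 𝟙 d * 𝟙 e
𝟙-×-dec d e with does d | does e
... | true  | true  = refl
... | true  | false = refl
... | false | _     = refl

𝟙-≤+𝟙-≥ : ∀ {x y} (x≤?y : Dec (x ≤ y)) (y≤?x : Dec (y ≤ x)) (x≟y : Dec (x ≡ y)) →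
           𝟙 x≤?y + 𝟙 y≤?x ≡ 1 + 𝟙 x≟y
𝟙-≤+𝟙-≥ (yes _)   (yes _)   (yes _)    = refl
𝟙-≤+𝟙-≥ (yes x≤y) (yes y≤x) (no x≢y)   = contradiction (ℕP.≤-antisym x≤y y≤x) x≢y
𝟙-≤+𝟙-≥ (yes x≤y) (no y≰x)  (yes refl) = contradiction x≤y y≰x
𝟙-≤+𝟙-≥ (yes _)   (no _)    (no _)     = refl
𝟙-≤+𝟙-≥ (no x≰y)  (yes y≤x) (yes refl) = contradiction y≤x x≰y
𝟙-≤+𝟙-≥ (no _)    (yes _)   (no _)     = refl
𝟙-≤+𝟙-≥ (no x≰y)  (no y≰x)  _          = contradiction (ℕP.≰⇒≥ x≰y) y≰x

∑-1 : ∀ n → ∑[ i < n ] 1 ≡ n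
∑-1 zero    = refl
∑-1 (suc n) = cong suc (∑-1 n)

∑-support₁ : ∀ {n} (f : Fin n → ℕ) b → (∀ a → a ≢ b → f a ≡ 0) → sum f ≡ f b
∑-support₁ {suc n} f b f≡0 = begin
  sum f                        ≡⟨ sum-remove {i = b} f ⟩
  f b + ∑[ a < n ] f (punchIn b a) ≡⟨ cong (_+_ (f b)) (sum-cong-≗ (λ a → f≡0 _ (punchInᵢ≢i b a))) ⟩
  f b + ∑[ a < n ] 0            ≡⟨ cong (_+_ (f b)) (sum-replicate-zero n) ⟩
  f b + 0                      ≡⟨ ℕP.+-identityʳ (f b) ⟩
  f b                          ∎
  where open ≡-Reasoning

∑-support₂ : ∀ {n} (f : Fin n → ℕ) {b c} → b ≢ c → (∀ a → a ≢ b → a ≢ c → f a ≡ 0) → sum f ≡ f b + f c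
∑-support₂ {suc n} f {b} {c} b≢c f≡0 = begin
  sum f                            ≡⟨ sum-remove {i = b} f ⟩
  f b + ∑[ a < n ] f (punchIn b a) ≡⟨ cong (_+_ (f b)) (∑-support₁ (f ∘ punchIn b) c′ vanish) ⟩
  f b + f (punchIn b c′)           ≡⟨ cong (λ x → f b + f x) (punchIn-punchOut b≢c) ⟩
  f b + f c                        ∎
  where
  open ≡-Reasoning
  c′ : Fin n
  c′ = punchOut b≢c
  vanish : ∀ a → a ≢ c′ → f (punchIn b a) ≡ 0
  vanish a a≢c′ = f≡0 _ (punchInᵢ≢i b a)
    (λ eq → a≢c′ (punchIn-injective b a c′ (trans eq (sym (punchIn-punchOut b≢c)))))

∑∑-* : ∀ {m n} (u : Fin m → ℕ) (v : Fin n → ℕ) → ∑[ a < m ] ∑[ b < n ] (u a * v b) ≡ sum u * sum v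
∑∑-* u v = begin
  ∑[ a < _ ] ∑[ b < _ ] (u a * v b) ≡⟨ sum-cong-≗ (λ a → sym (*-distribˡ-sum (u a) v)) ⟩
  ∑[ a < _ ] (u a * sum v)          ≡⟨ sym (*-distribʳ-sum (sum v) u) ⟩
  sum u * sum v                     ∎
  where open ≡-Reasoning

module _ {a p} {A : Set a} {P : Pred A p} (P? : Decidable P) where

  length-filter-tabulate : ∀ {n} (f : Fin n → A) → length (filter P? (tabulate f)) ≡ ∑[ i < n ] 𝟙 (P? (f i))
  length-filter-tabulate {zero}  f = refl
  length-filter-tabulate {suc n} f with does (P? (f zero))
  ... | true  = cong suc (length-filter-tabulate (f ∘ suc))
  ... | false = length-filter-tabulate (f ∘ suc)

module _ {a b p} {A : Set a} {B : Set b} {P : Pred (A × B) p} (P? : Decidable P) where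

  length-filter-cartesianProduct : ∀ {m n} (f : Fin m → A) (g : Fin n → B) →
    length (filter P? (cartesianProduct (tabulate f) (tabulate g))) ≡ ∑[ i < m ] ∑[ j < n ] 𝟙 (P? (f i , g j))
  length-filter-cartesianProduct {zero}  f g = refl
  length-filter-cartesianProduct {suc m} f g = begin
    length (filter P? (row ++ rest))                      ≡⟨ cong length (filter-++ P? row rest) ⟩
    length (filter P? row ++ filter P? rest)              ≡⟨ length-++ (filter P? row) ⟩
    length (filter P? row) + length (filter P? rest)
      ≡⟨ cong₂ _+_ (trans (cong (length ∘ filter P?) (map-tabulate g (f zero ,_))) (length-filter-tabulate P? ((f zero ,_) ∘ g)))
                   (length-filter-cartesianProduct (f ∘ suc) g) ⟩
    _                                                     ∎
    where
    open ≡-Reasoning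
    row rest : List (A × B)
    row  = map (f zero ,_) (tabulate g)
    rest = cartesianProduct (tabulate (f ∘ suc)) (tabulate g)

∣∧<⇒≡0 : ∀ {m d} → m ℕ∣.∣ d → d < m → d ≡ 0
∣∧<⇒≡0 {d = zero}  _   _   = refl
∣∧<⇒≡0 {d = suc _} m∣d d<m = contradiction m∣d (>⇒∤ d<m)

¬t*2∣t : ∀ {t} → t ≢ 0 → ¬ (t * 2 ℕ∣.∣ t)
¬t*2∣t {zero}  t≢0 = contradiction refl t≢0
¬t*2∣t {suc t} _   = >⇒∤ (ℕP.m<m*n (suc t) 2 (ℕ.s≤s (ℕ.s≤s ℕ.z≤n)))

ℤ-parity : ∀ q → q ≡ (q /ℕ 2) ℤ.* + 2 ⊎ q ≡ ℤ.1ℤ ℤ.+ (q /ℕ 2) ℤ.* + 2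
ℤ-parity q = by-remainder (q %ℕ 2) (n%ℕd<d q 2) (a≡a%ℕn+[a/ℕn]*n q 2)
  where
  by-remainder : ∀ r → r < 2 → q ≡ + r ℤ.+ (q /ℕ 2) ℤ.* + 2 →
                 q ≡ (q /ℕ 2) ℤ.* + 2 ⊎ q ≡ ℤ.1ℤ ℤ.+ (q /ℕ 2) ℤ.* + 2
  by-remainder 0 _ q≡ = inj₁ (trans q≡ (ℤP.+-identityˡ ((q /ℕ 2) ℤ.* + 2)))
  by-remainder 1 _ q≡ = inj₂ q≡
  by-remainder (suc (suc _)) (ℕ.s≤s (ℕ.s≤s ())) _

strictlyMonotone⇒injective : (f : ℕ → ℕ) → (∀ {x y} → x < y → f x < f y) → ∀ {x y} → f x ≡ f y → x ≡ y
strictlyMonotone⇒injective f mono {x} {y} fx≡fy with ℕP.<-cmp x y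
... | tri< x<y _ _ = contradiction fx≡fy (ℕP.<⇒≢ (mono x<y))
... | tri≈ _ x≡y _ = x≡y
... | tri> _ _ y<x = contradiction (sym fx≡fy) (ℕP.<⇒≢ (mono y<x))

+-double-injective : ∀ {x y} → x + x ≡ y + y → x ≡ y
+-double-injective = strictlyMonotone⇒injective (λ x → x + x) (λ x<y → ℕP.+-mono-< x<y x<y)

-- Over ℤ this is y·y′ expanded with y = 1 + c − x and y′ = 1 + c′ − x′; both sides
-- are arranged so that no subtraction occurs.
cross-identity : ∀ x y c x′ y′ c′ → x + y ≡ 1 + c → x′ + y′ ≡ 1 + c′ →
  y * y′ + x * 1 + 1 * x′ + c * x′ + x * c′ ≡ x * x′ + 1 * 1 + c * 1 + 1 * c′ + c * c′
cross-identity x y c x′ y′ c′ x+y≡1+c x′+y′≡1+c′ = begin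
  y * y′ + x * 1 + 1 * x′ + c * x′ + x * c′ ≡⟨ regroup x y c x′ y′ c′ ⟩
  y * y′ + x * (1 + c′) + (1 + c) * x′
    ≡⟨ cong₂ (λ u v → y * y′ + x * u + v * x′) (sym x′+y′≡1+c′) (sym x+y≡1+c) ⟩
  y * y′ + x * (x′ + y′) + (x + y) * x′     ≡⟨ factor x y x′ y′ ⟩
  (x + y) * (x′ + y′) + x * x′              ≡⟨ cong₂ (λ u v → u * v + x * x′) x+y≡1+c x′+y′≡1+c′ ⟩
  (1 + c) * (1 + c′) + x * x′               ≡⟨ expand x c x′ c′ ⟩
  x * x′ + 1 * 1 + c * 1 + 1 * c′ + c * c′  ∎
  where
  open ≡-Reasoning
  regroup : ∀ x y c x′ y′ c′ →
    y * y′ + x * 1 + 1 * x′ + c * x′ + x * c′ ≡ y * y′ + x * (1 + c′) + (1 + c) * x′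
  regroup = solve-∀
  factor : ∀ x y x′ y′ → y * y′ + x * (x′ + y′) + (x + y) * x′ ≡ (x + y) * (x′ + y′) + x * x′
  factor = solve-∀
  expand : ∀ x c x′ c′ → (1 + c) * (1 + c′) + x * x′ ≡ x * x′ + 1 * 1 + c * 1 + 1 * c′ + c * c′
  expand = solve-∀

eliminate-squares : ∀ {oA oB oC dA dB dC d₁ rA rC t} →
  oB + (t + t) ≡ oA + 2 + oC →
  rA + rA ≡ oA + dA → rA + rA ≡ oB + dB → rC + rC ≡ oC + dC → dA + dB ≡ d₁ + dC →
  (t + dA) + (t + dA) ≡ 2 + d₁ + (rC + rC)
eliminate-squares {oA} {oB} {oC} {dA} {dB} {dC} {d₁} {rA} {rC} {t} hO hA hB hC hD =
  ℕP.+-cancelˡ-≡ (oB + dB) _ _ (begin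
    (oB + dB) + ((t + dA) + (t + dA))  ≡⟨ shuffle₁ oB dB t dA ⟩
    (oB + (t + t)) + (dB + dA + dA)    ≡⟨ cong (_+ (dB + dA + dA)) hO ⟩
    (oA + 2 + oC) + (dB + dA + dA)     ≡⟨ shuffle₂ oA oC dA dB ⟩
    (oA + dA) + (2 + oC + (dA + dB))   ≡⟨ cong₂ (λ u v → u + (2 + oC + v)) (trans (sym hA) hB) hD ⟩
    (oB + dB) + (2 + oC + (d₁ + dC))   ≡⟨ cong (_+_ (oB + dB)) (shuffle₃ oC d₁ dC) ⟩
    (oB + dB) + (2 + d₁ + (oC + dC))   ≡⟨ cong (λ u → (oB + dB) + (2 + d₁ + u)) (sym hC) ⟩
    (oB + dB) + (2 + d₁ + (rC + rC))   ∎)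
  where
  open ≡-Reasoning
  shuffle₁ : ∀ oB dB t dA → (oB + dB) + ((t + dA) + (t + dA)) ≡ (oB + (t + t)) + (dB + dA + dA)
  shuffle₁ = solve-∀
  shuffle₂ : ∀ oA oC dA dB → (oA + 2 + oC) + (dB + dA + dA) ≡ (oA + dA) + (2 + oC + (dA + dB))
  shuffle₂ = solve-∀
  shuffle₃ : ∀ oC d₁ dC → 2 + oC + (d₁ + dC) ≡ 2 + d₁ + (oC + dC)
  shuffle₃ = solve-∀

𝟙ˢ : ∀ {n} → Subset n → Fin n → ℕ
𝟙ˢ S a = 𝟙 (a ∈? S)

𝟙ˢ-∪-∩ : ∀ {n} {A B C : Subset n} → A ∪ B ≡ ⊤ → A ∩ B ≡ C → ∀ a → 𝟙ˢ A a + 𝟙ˢ B a ≡ 1 + 𝟙ˢ C a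
𝟙ˢ-∪-∩ {A = A} {B} {C} A∪B≡⊤ A∩B≡C a with a ∈? A | a ∈? B
... | yes a∈A | yes a∈B = cong suc (sym (𝟙-yes (a ∈? C) (subst (a ∈_) A∩B≡C (x∈p∩q⁺ (a∈A , a∈B)))))
... | yes _   | no a∉B  = cong suc (sym (𝟙-no (a ∈? C) (a∉B ∘ proj₂ ∘ x∈p∩q⁻ A B ∘ subst (a ∈_) (sym A∩B≡C))))
... | no a∉A  | yes _   = cong suc (sym (𝟙-no (a ∈? C) (a∉A ∘ proj₁ ∘ x∈p∩q⁻ A B ∘ subst (a ∈_) (sym A∩B≡C))))
... | no a∉A  | no a∉B  = contradiction (x∈p∪q⁻ A B (subst (a ∈_) (sym A∪B≡⊤) ∈⊤)) Sum.[ a∉A , a∉B ]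

∑-𝟙ˢ-pair : ∀ {n} {r₁ r₂ : Fin n} → r₁ ≢ r₂ → ∀ (h : Fin n → ℕ) →
            ∑[ a < n ] (𝟙ˢ (⁅ r₁ ⁆ ∪ ⁅ r₂ ⁆) a * h a) ≡ h r₁ + h r₂
∑-𝟙ˢ-pair {n} {r₁} {r₂} r₁≢r₂ h =
  trans (∑-support₂ (λ a → 𝟙ˢ pair a * h a) r₁≢r₂ vanish)
        (cong₂ _+_ (member (inj₁ (x∈⁅x⁆ r₁))) (member (inj₂ (x∈⁅x⁆ r₂))))
  where
  pair : Subset n
  pair = ⁅ r₁ ⁆ ∪ ⁅ r₂ ⁆
  member : ∀ {a} → a ∈ ⁅ r₁ ⁆ ⊎ a ∈ ⁅ r₂ ⁆ → 𝟙ˢ pair a * h a ≡ h a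
  member {a} a∈ = trans (cong (_* h a) (𝟙-yes (a ∈? pair) (x∈p∪q⁺ a∈))) (ℕP.*-identityˡ (h a))
  vanish : ∀ a → a ≢ r₁ → a ≢ r₂ → 𝟙ˢ pair a * h a ≡ 0
  vanish a a≢r₁ a≢r₂ = cong (_* h a) (𝟙-no (a ∈? pair)
    (Sum.[ a≢r₁ ∘ x∈⁅y⁆⇒x≡y r₁ , a≢r₂ ∘ x∈⁅y⁆⇒x≡y r₂ ] ∘ x∈p∪q⁻ ⁅ r₁ ⁆ ⁅ r₂ ⁆))

χ≡𝟙ˢ : ∀ m .{{_ : NonZero m}} A N → χ m A N ≡ 𝟙ˢ A (res m N)
χ≡𝟙ˢ m A N with res m N ∈? A
... | yes _ = refl
... | no _  = refl

module Residues (m : ℕ) .{{_ : NonZero m}} where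

  ⟨_⟩ : Fin m → ℤ
  ⟨ a ⟩ = + toℕ a

  toℕ-res : ∀ x → toℕ (res m x) ≡ x %ℕ m
  toℕ-res x = toℕ-fromℕ< (n%ℕd<d x m)

  res-⟨⟩ : ∀ a → res m ⟨ a ⟩ ≡ a
  res-⟨⟩ a = toℕ-injective (trans (toℕ-res ⟨ a ⟩) (m<n⇒m%n≡m (toℕ<n a)))

  ∣-minus-%ℕ : ∀ x → + m ∣ₛ x - + (x %ℕ m)
  ∣-minus-%ℕ x = divides (x /ℕ m) (begin
    x - + (x %ℕ m)                                  ≡⟨ cong (_- + (x %ℕ m)) (a≡a%ℕn+[a/ℕn]*n x m) ⟩
    + (x %ℕ m) ℤ.+ (x /ℕ m) ℤ.* + m - + (x %ℕ m)   ≡⟨ cancel (+ (x %ℕ m)) (x /ℕ m ℤ.* + m) ⟩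
    (x /ℕ m) ℤ.* + m                                ∎)
    where
    open ≡-Reasoning
    cancel : ∀ r k → r ℤ.+ k - r ≡ k
    cancel = ℤ-solve-∀

  ∣-small⇒≡ : ∀ {r s} → r < m → s < m → + m ∣ₛ + r - + s → r ≡ s
  ∣-small⇒≡ {r} {s} r<m s<m m∣r-s =
    ℤP.+-injective (ℤP.i-j≡0⇒i≡j _ _ (ℤP.∣i∣≡0⇒i≡0 (∣∧<⇒≡0 (∣⇒∣ᵤ m∣r-s) ∣r-s∣<m)))
    where
    ∣r-s∣<m : ℤ.∣ + r - + s ∣ < m
    ∣r-s∣<m = ℕP.≤-<-trans
      (subst (λ z → ℤ.∣ z ∣ ≤ r ℕ.⊔ s) (sym (ℤP.m-n≡m⊖n r s)) (ℤP.∣m⊝n∣≤m⊔n r s))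
      (ℕP.⊔-lub r<m s<m)

  res≡⇒∣ : ∀ {x y} → res m x ≡ res m y → + m ∣ₛ x - y
  res≡⇒∣ {x} {y} eq = subst (+ m ∣ₛ_)
    (trans (cong (λ s → (x - + (x %ℕ m)) - (y - + s)) (sym r≡s)) (drop x y (+ (x %ℕ m))))
    (∣m∣n⇒∣m-n (∣-minus-%ℕ x) (∣-minus-%ℕ y))
    where
    r≡s : x %ℕ m ≡ y %ℕ m
    r≡s = trans (sym (toℕ-res x)) (trans (cong toℕ eq) (toℕ-res y))
    drop : ∀ x y r → (x - r) - (y - r) ≡ x - y
    drop = ℤ-solve-∀

  ∣⇒res≡ : ∀ {x y} → + m ∣ₛ x - y → res m x ≡ res m y
  ∣⇒res≡ {x} {y} m∣x-y = toℕ-injective (trans (toℕ-res x) (trans r≡s (sym (toℕ-res y))))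
    where
    regroup : ∀ x y r s → (x - y) - ((x - r) - (y - s)) ≡ r - s
    regroup = ℤ-solve-∀
    r≡s : x %ℕ m ≡ y %ℕ m
    r≡s = ∣-small⇒≡ (n%ℕd<d x m) (n%ℕd<d y m)
      (subst (+ m ∣ₛ_) (regroup x y _ _) (∣m∣n⇒∣m-n m∣x-y (∣m∣n⇒∣m-n (∣-minus-%ℕ x) (∣-minus-%ℕ y))))

  res-≡-diff : ∀ {x y x′ y′} → x - y ≡ x′ - y′ → res m x ≡ res m y → res m x′ ≡ res m y′
  res-≡-diff {x} {y} {x′} {y′} eq = ∣⇒res≡ {x′} {y′} ∘ subst (+ m ∣ₛ_) eq ∘ res≡⇒∣ {x} {y}

  res-+ : ∀ {x x′ y y′} → res m x ≡ res m x′ → res m y ≡ res m y′ → res m (x ℤ.+ y) ≡ res m (x′ ℤ.+ y′)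
  res-+ {x} {x′} {y} {y′} p q = ∣⇒res≡ {x ℤ.+ y} {x′ ℤ.+ y′}
    (subst (+ m ∣ₛ_) (regroup x x′ y y′) (∣m∣n⇒∣m+n (res≡⇒∣ {x} {x′} p) (res≡⇒∣ {y} {y′} q)))
    where
    regroup : ∀ x x′ y y′ → (x - x′) ℤ.+ (y - y′) ≡ (x ℤ.+ y) - (x′ ℤ.+ y′)
    regroup = ℤ-solve-∀

  res-+m : ∀ x → res m (x ℤ.+ + m) ≡ res m x
  res-+m x = ∣⇒res≡ {x ℤ.+ + m} {x} (divides ℤ.1ℤ (shift x (+ m)))
    where
    shift : ∀ x k → (x ℤ.+ k) - x ≡ ℤ.1ℤ ℤ.* k
    shift = ℤ-solve-∀

  ⟨a⟩+⟨a⟩≡N⇒2∣N : ∀ {a N} → 2 ℕ∣.∣ m → res m (⟨ a ⟩ ℤ.+ ⟨ a ⟩) ≡ res m N → + 2 ∣ℤ N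
  ⟨a⟩+⟨a⟩≡N⇒2∣N {a} {N} 2∣m a+a≡N = ∣⇒∣ᵤ (subst (+ 2 ∣ₛ_) (cancel ⟨ a ⟩ N)
    (∣m∣n⇒∣m-n (divides ⟨ a ⟩ (double ⟨ a ⟩))
               (∣-trans (∣ᵤ⇒∣ 2∣m) (res≡⇒∣ {⟨ a ⟩ ℤ.+ ⟨ a ⟩} {N} a+a≡N))))
    where
    double : ∀ a → a ℤ.+ a ≡ a ℤ.* + 2
    double = ℤ-solve-∀
    cancel : ∀ a N → (a ℤ.+ a) - ((a ℤ.+ a) - N) ≡ N
    cancel = ℤ-solve-∀

  module Halves {t} (m≡t*2 : m ≡ t * 2) {N k j : ℤ} (N≡2k : N ≡ + 2 ℤ.* k) (N+m≡2j : N ℤ.+ + m ≡ + 2 ℤ.* j) where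

    +m≡2t : + m ≡ + 2 ℤ.* + t
    +m≡2t = trans (cong +_ (trans m≡t*2 (ℕP.*-comm t 2))) (ℤP.pos-* 2 t)

    j≡k+t : j ≡ k ℤ.+ + t
    j≡k+t = ℤP.*-cancelˡ-≡ (+ 2) j (k ℤ.+ + t) (begin
      + 2 ℤ.* j                  ≡⟨ sym N+m≡2j ⟩
      N ℤ.+ + m                  ≡⟨ cong₂ ℤ._+_ N≡2k +m≡2t ⟩
      + 2 ℤ.* k ℤ.+ + 2 ℤ.* + t  ≡⟨ sym (ℤP.*-distribˡ-+ (+ 2) k (+ t)) ⟩
      + 2 ℤ.* (k ℤ.+ + t)        ∎)
      where open ≡-Reasoning

    half-k : res m (⟨ res m k ⟩ ℤ.+ ⟨ res m k ⟩) ≡ res m N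
    half-k = trans (res-+ {⟨ res m k ⟩} {k} {⟨ res m k ⟩} {k} (res-⟨⟩ (res m k)) (res-⟨⟩ (res m k)))
                   (cong (res m) (trans (double k) (sym N≡2k)))
      where
      double : ∀ k → k ℤ.+ k ≡ + 2 ℤ.* k
      double = ℤ-solve-∀

    half-j : res m (⟨ res m j ⟩ ℤ.+ ⟨ res m j ⟩) ≡ res m N
    half-j = trans (res-+ {⟨ res m j ⟩} {j} {⟨ res m j ⟩} {j} (res-⟨⟩ (res m j)) (res-⟨⟩ (res m j)))
                   (trans (cong (res m) (trans (double j) (sym N+m≡2j))) (res-+m N))
      where
      double : ∀ j → j ℤ.+ j ≡ + 2 ℤ.* j
      double = ℤ-solve-∀

    res-k≢res-j : res m k ≢ res m j
    res-k≢res-j k≡j = ¬t*2∣t t≢0 (subst (ℕ∣._∣ t) m≡t*2 m∣t)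
      where
      t≢0 : t ≢ 0
      t≢0 t≡0 = ℕ.≢-nonZero⁻¹ m (trans m≡t*2 (cong (_* 2) t≡0))
      k-j≡-t : k - j ≡ ℤ.- + t
      k-j≡-t = trans (cong (k -_) j≡k+t) (cancel k (+ t))
        where
        cancel : ∀ k t → k - (k ℤ.+ t) ≡ ℤ.- t
        cancel = ℤ-solve-∀
      m∣t : m ℕ∣.∣ t
      m∣t = subst (m ℕ∣.∣_) (ℤP.∣-i∣≡∣i∣ (+ t))
              (∣⇒∣ᵤ (subst (+ m ∣ₛ_) k-j≡-t (res≡⇒∣ {k} {j} k≡j)))

    only-halves : ∀ a → res m (⟨ a ⟩ ℤ.+ ⟨ a ⟩) ≡ res m N → a ≡ res m k ⊎ a ≡ res m j
    only-halves a a+a≡N = Sum.map (congruent k ∘ q-even) (congruent j ∘ q-odd) (ℤ-parity q)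
      where
      t∣a-k : + t ∣ₛ ⟨ a ⟩ - k
      t∣a-k = *-cancelˡ-∣ (+ 2) (subst₂ _∣ₛ_ +m≡2t (trans (cong (⟨ a ⟩ ℤ.+ ⟨ a ⟩ -_) N≡2k) (factor ⟨ a ⟩ k))
                                                 (res≡⇒∣ {⟨ a ⟩ ℤ.+ ⟨ a ⟩} {N} a+a≡N))
        where
        factor : ∀ a k → (a ℤ.+ a) - + 2 ℤ.* k ≡ + 2 ℤ.* (a - k)
        factor = ℤ-solve-∀
      q s : ℤ
      q = quotient t∣a-k
      s = q /ℕ 2
      a-k≡qt : ⟨ a ⟩ - k ≡ q ℤ.* + t
      a-k≡qt = _∣ₛ_.equality t∣a-k
      congruent : ∀ x → ⟨ a ⟩ - x ≡ s ℤ.* + m → a ≡ res m x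
      congruent x eq = trans (sym (res-⟨⟩ a)) (∣⇒res≡ {⟨ a ⟩} {x} (divides s eq))
      q-even : q ≡ s ℤ.* + 2 → ⟨ a ⟩ - k ≡ s ℤ.* + m
      q-even q≡2s = begin
        ⟨ a ⟩ - k            ≡⟨ a-k≡qt ⟩
        q ℤ.* + t            ≡⟨ cong (ℤ._* + t) q≡2s ⟩
        s ℤ.* + 2 ℤ.* + t    ≡⟨ regroup s (+ t) ⟩
        s ℤ.* (+ 2 ℤ.* + t)  ≡⟨ cong (s ℤ.*_) (sym +m≡2t) ⟩
        s ℤ.* + m            ∎
        where
        open ≡-Reasoning
        regroup : ∀ s t → s ℤ.* + 2 ℤ.* t ≡ s ℤ.* (+ 2 ℤ.* t)
        regroup = ℤ-solve-∀
      q-odd : q ≡ ℤ.1ℤ ℤ.+ s ℤ.* + 2 → ⟨ a ⟩ - j ≡ s ℤ.* + m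
      q-odd q≡1+2s = begin
        ⟨ a ⟩ - j                          ≡⟨ cong (⟨ a ⟩ -_) j≡k+t ⟩
        ⟨ a ⟩ - (k ℤ.+ + t)                ≡⟨ regroup₁ ⟨ a ⟩ k (+ t) ⟩
        (⟨ a ⟩ - k) - + t                  ≡⟨ cong (_- + t) (trans a-k≡qt (cong (ℤ._* + t) q≡1+2s)) ⟩
        (ℤ.1ℤ ℤ.+ s ℤ.* + 2) ℤ.* + t - + t ≡⟨ regroup₂ s (+ t) ⟩
        s ℤ.* (+ 2 ℤ.* + t)                ≡⟨ cong (s ℤ.*_) (sym +m≡2t) ⟩
        s ℤ.* + m                          ∎
        where
        open ≡-Reasoning
        regroup₁ : ∀ a k t → a - (k ℤ.+ t) ≡ (a - k) - t
        regroup₁ = ℤ-solve-∀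
        regroup₂ : ∀ s t → (ℤ.1ℤ ℤ.+ s ℤ.* + 2) ℤ.* t - t ≡ s ℤ.* (+ 2 ℤ.* t)
        regroup₂ = ℤ-solve-∀


module Convolution (m : ℕ) .{{_ : NonZero m}} where

  open Residues m

  -- E n a b = [a + b = n in ℤ_m], decided by the same test as in the definition of R.
  sums? : ∀ (n a b : Fin m) → Dec ((toℕ a + toℕ b) ℕ.% m ≡ toℕ n)
  sums? n a b = (toℕ a + toℕ b) ℕ.% m ℕ.≟ toℕ n

  E : Fin m → Fin m → Fin m → ℕ
  E n a b = 𝟙 (sums? n a b)

  E-comm : ∀ n a b → E n a b ≡ E n b a
  E-comm n a b = cong (λ s → 𝟙 (s ℕ.% m ℕ.≟ toℕ n)) (ℕP.+-comm (toℕ a) (toℕ b))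

  E≡1 : ∀ n a b → res m (⟨ a ⟩ ℤ.+ ⟨ b ⟩) ≡ n → E n a b ≡ 1
  E≡1 n a b a+b≡n = 𝟙-yes (sums? n a b) (trans (sym (toℕ-res (⟨ a ⟩ ℤ.+ ⟨ b ⟩))) (cong toℕ a+b≡n))

  E≡0 : ∀ n a b → res m (⟨ a ⟩ ℤ.+ ⟨ b ⟩) ≢ n → E n a b ≡ 0
  E≡0 n a b a+b≢n = 𝟙-no (sums? n a b) (a+b≢n ∘ toℕ-injective ∘ trans (toℕ-res (⟨ a ⟩ ℤ.+ ⟨ b ⟩)))

  one : Fin m → ℕ
  one _ = 1

  δ : Fin m → Fin m → ℕ
  δ a b = 𝟙 (toℕ a ℕ.≟ toℕ b)

  δ-vanish : ∀ {a b} x → b ≢ a → x * δ a b ≡ 0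
  δ-vanish {a} {b} x b≢a = trans (cong (x *_) (𝟙-no (toℕ a ℕ.≟ toℕ b) (b≢a ∘ sym ∘ toℕ-injective))) (ℕP.*-zeroʳ x)

  fiberSum : (Fin m → Fin m → ℕ) → Fin m → ℕ
  fiberSum K n = ∑[ a < m ] ∑[ b < m ] (K a b * E n a b)

  _⋆_ : (Fin m → ℕ) → (Fin m → ℕ) → Fin m → ℕ
  u ⋆ v = fiberSum (λ a b → u a * v b)

  diagonalSum : (Fin m → ℕ) → Fin m → ℕ
  diagonalSum u n = ∑[ a < m ] (u a * E n a a)

  fiberSum-cong : ∀ {K L} → (∀ a b → K a b ≡ L a b) → ∀ n → fiberSum K n ≡ fiberSum L n
  fiberSum-cong K≡L n = sum-cong-≗ (λ a → sum-cong-≗ (λ b → cong (_* E n a b) (K≡L a b)))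

  fiberSum-+ : ∀ (K L : Fin m → Fin m → ℕ) n → fiberSum (λ a b → K a b + L a b) n ≡ fiberSum K n + fiberSum L n
  fiberSum-+ K L n = trans
    (sum-cong-≗ {m} (λ a → trans (sum-cong-≗ {m} (λ b → ℕP.*-distribʳ-+ (E n a b) (K a b) (L a b)))
                                 (∑-distrib-+ (λ b → K a b * E n a b) (λ b → L a b * E n a b))))
    (∑-distrib-+ (λ a → ∑[ b < m ] (K a b * E n a b)) (λ a → ∑[ b < m ] (L a b * E n a b)))

  fiberSum-transpose : ∀ (K : Fin m → Fin m → ℕ) n → fiberSum (λ a b → K b a) n ≡ fiberSum K n
  fiberSum-transpose K n = trans (∑-comm (λ a b → K b a * E n a b))
    (sum-cong-≗ {m} (λ b → sum-cong-≗ {m} (λ a → cong (K b a *_) (E-comm n a b))))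

  ⋆-comm : ∀ (u v : Fin m → ℕ) n → (u ⋆ v) n ≡ (v ⋆ u) n
  ⋆-comm u v n = trans (fiberSum-cong (λ a b → ℕP.*-comm (u a) (v b)) n) (fiberSum-transpose (λ a b → v a * u b) n)

  fiberSum-at : ∀ (K : Fin m → Fin m → ℕ) N → fiberSum K (res m N) ≡ ∑[ a < m ] K a (res m (N - ⟨ a ⟩))
  fiberSum-at K N = sum-cong-≗ {m} row
    where
    row : ∀ a → ∑[ b < m ] (K a b * E (res m N) a b) ≡ K a (res m (N - ⟨ a ⟩))
    row a = begin
      ∑[ b < m ] (K a b * E (res m N) a b) ≡⟨ ∑-support₁ (λ b → K a b * E (res m N) a b) b₀ vanish ⟩
      K a b₀ * E (res m N) a b₀            ≡⟨ cong (K a b₀ *_) (E≡1 (res m N) a b₀ hit) ⟩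
      K a b₀ * 1                           ≡⟨ ℕP.*-identityʳ (K a b₀) ⟩
      K a b₀                               ∎
      where
      open ≡-Reasoning
      b₀ : Fin m
      b₀ = res m (N - ⟨ a ⟩)
      hit : res m (⟨ a ⟩ ℤ.+ ⟨ b₀ ⟩) ≡ res m N
      hit = trans (res-+ {⟨ a ⟩} {⟨ a ⟩} {⟨ b₀ ⟩} {N - ⟨ a ⟩} refl (res-⟨⟩ b₀)) (cong (res m) (cancel ⟨ a ⟩ N))
        where
        cancel : ∀ a N → a ℤ.+ (N - a) ≡ N
        cancel = ℤ-solve-∀
      vanish : ∀ b → b ≢ b₀ → K a b * E (res m N) a b ≡ 0
      vanish b b≢b₀ = trans (cong (K a b *_) (E≡0 (res m N) a b (b≢b₀ ∘ solution))) (ℕP.*-zeroʳ (K a b))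
        where
        shift : ∀ a b N → (a ℤ.+ b) - N ≡ b - (N - a)
        shift = ℤ-solve-∀
        solution : res m (⟨ a ⟩ ℤ.+ ⟨ b ⟩) ≡ res m N → b ≡ b₀
        solution = trans (sym (res-⟨⟩ b))
                 ∘ res-≡-diff {⟨ a ⟩ ℤ.+ ⟨ b ⟩} {N} {⟨ b ⟩} {N - ⟨ a ⟩} (shift ⟨ a ⟩ ⟨ b ⟩ N)

  ∑-fiberSum : ∀ (K : Fin m → Fin m → ℕ) → ∑[ n < m ] fiberSum K n ≡ ∑[ a < m ] ∑[ b < m ] K a b
  ∑-fiberSum K = begin
    ∑[ n < m ] ∑[ a < m ] ∑[ b < m ] (K a b * E n a b) ≡⟨ ∑-comm (λ n a → ∑[ b < m ] (K a b * E n a b)) ⟩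
    ∑[ a < m ] ∑[ n < m ] ∑[ b < m ] (K a b * E n a b) ≡⟨ sum-cong-≗ {m} (λ a → ∑-comm (λ n b → K a b * E n a b)) ⟩
    ∑[ a < m ] ∑[ b < m ] ∑[ n < m ] (K a b * E n a b) ≡⟨ sum-cong-≗ {m} (λ a → sum-cong-≗ {m} (column a)) ⟩
    ∑[ a < m ] ∑[ b < m ] K a b                        ∎
    where
    open ≡-Reasoning
    column : ∀ a b → ∑[ n < m ] (K a b * E n a b) ≡ K a b
    column a b = begin
      ∑[ n < m ] (K a b * E n a b) ≡⟨ ∑-support₁ (λ n → K a b * E n a b) n₀ vanish ⟩
      K a b * E n₀ a b             ≡⟨ cong (K a b *_) (E≡1 n₀ a b refl) ⟩
      K a b * 1                    ≡⟨ ℕP.*-identityʳ (K a b) ⟩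
      K a b                        ∎
      where
      n₀ : Fin m
      n₀ = res m (⟨ a ⟩ ℤ.+ ⟨ b ⟩)
      vanish : ∀ n → n ≢ n₀ → K a b * E n a b ≡ 0
      vanish n n≢n₀ = trans (cong (K a b *_) (E≡0 n a b (n≢n₀ ∘ sym))) (ℕP.*-zeroʳ (K a b))

  fiberSum-δ : ∀ (K : Fin m → Fin m → ℕ) n → fiberSum (λ a b → K a b * δ a b) n ≡ diagonalSum (λ a → K a a) n
  fiberSum-δ K n = sum-cong-≗ {m} (λ a → begin
    ∑[ b < m ] (K a b * δ a b * E n a b)
      ≡⟨ ∑-support₁ (λ b → K a b * δ a b * E n a b) a (λ b b≢a → cong (_* E n a b) (δ-vanish (K a b) b≢a)) ⟩
    K a a * δ a a * E n a a             ≡⟨ cong (λ x → K a a * x * E n a a) (𝟙-yes (toℕ a ℕ.≟ toℕ a) refl) ⟩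
    K a a * 1 * E n a a                 ≡⟨ cong (_* E n a a) (ℕP.*-identityʳ (K a a)) ⟩
    K a a * E n a a                     ∎)
    where open ≡-Reasoning

  ∑-diagonalSum : ∀ (u : Fin m → ℕ) → ∑[ n < m ] diagonalSum u n ≡ sum u
  ∑-diagonalSum u = begin
    ∑[ n < m ] diagonalSum u n                ≡⟨ sum-cong-≗ {m} (λ n → sym (fiberSum-δ (λ a _ → u a) n)) ⟩
    ∑[ n < m ] fiberSum (λ a b → u a * δ a b) n ≡⟨ ∑-fiberSum (λ a b → u a * δ a b) ⟩
    ∑[ a < m ] ∑[ b < m ] (u a * δ a b)       ≡⟨ sum-cong-≗ {m} diagonal ⟩
    sum u                                     ∎
    where
    open ≡-Reasoning
    diagonal : ∀ a → ∑[ b < m ] (u a * δ a b) ≡ u a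
    diagonal a = begin
      ∑[ b < m ] (u a * δ a b) ≡⟨ ∑-support₁ (λ b → u a * δ a b) a (λ b → δ-vanish (u a)) ⟩
      u a * δ a a              ≡⟨ cong (u a *_) (𝟙-yes (toℕ a ℕ.≟ toℕ a) refl) ⟩
      u a * 1                  ≡⟨ ℕP.*-identityʳ (u a) ⟩
      u a                      ∎

  ordered : Fin m → Fin m → ℕ
  ordered a b = 𝟙 (toℕ a ℕ.≤? toℕ b)

  fiberSum-ordered-double : ∀ (K : Fin m → Fin m → ℕ) → (∀ a b → K a b ≡ K b a) → ∀ n →
    fiberSum (λ a b → K a b * ordered a b) n + fiberSum (λ a b → K a b * ordered a b) n
      ≡ fiberSum K n + diagonalSum (λ a → K a a) n
  fiberSum-ordered-double K K-sym n = begin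
    fiberSum (λ a b → K a b * ordered a b) n + fiberSum (λ a b → K a b * ordered a b) n
      ≡⟨ cong (_+_ (fiberSum (λ a b → K a b * ordered a b) n)) transposed ⟩
    fiberSum (λ a b → K a b * ordered a b) n + fiberSum (λ a b → K a b * ordered b a) n
      ≡⟨ sym (fiberSum-+ (λ a b → K a b * ordered a b) (λ a b → K a b * ordered b a) n) ⟩
    fiberSum (λ a b → K a b * ordered a b + K a b * ordered b a) n
      ≡⟨ fiberSum-cong split n ⟩
    fiberSum (λ a b → K a b + K a b * δ a b) n
      ≡⟨ fiberSum-+ K (λ a b → K a b * δ a b) n ⟩
    fiberSum K n + fiberSum (λ a b → K a b * δ a b) n
      ≡⟨ cong (_+_ (fiberSum K n)) (fiberSum-δ K n) ⟩
    fiberSum K n + diagonalSum (λ a → K a a) n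
      ∎
    where
    open ≡-Reasoning
    transposed : fiberSum (λ a b → K a b * ordered a b) n ≡ fiberSum (λ a b → K a b * ordered b a) n
    transposed = trans (sym (fiberSum-transpose (λ a b → K a b * ordered a b) n))
                       (fiberSum-cong (λ a b → cong (_* ordered b a) (K-sym b a)) n)
    split : ∀ a b → K a b * ordered a b + K a b * ordered b a ≡ K a b + K a b * δ a b
    split a b = begin
      K a b * ordered a b + K a b * ordered b a ≡⟨ sym (ℕP.*-distribˡ-+ (K a b) (ordered a b) (ordered b a)) ⟩
      K a b * (ordered a b + ordered b a)
        ≡⟨ cong (K a b *_) (𝟙-≤+𝟙-≥ (toℕ a ℕ.≤? toℕ b) (toℕ b ℕ.≤? toℕ a) (toℕ a ℕ.≟ toℕ b)) ⟩
      K a b * (1 + δ a b)                       ≡⟨ ℕP.*-distribˡ-+ (K a b) 1 (δ a b) ⟩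
      K a b * 1 + K a b * δ a b                 ≡⟨ cong (_+ K a b * δ a b) (ℕP.*-identityʳ (K a b)) ⟩
      K a b + K a b * δ a b                     ∎

  diagonalSum-odd : ∀ N → 2 ℕ∣.∣ m → ¬ (+ 2 ∣ℤ N) → ∀ u → diagonalSum u (res m N) ≡ 0
  diagonalSum-odd N 2∣m N-odd u = trans (sum-cong-≗ {m} vanish) (sum-replicate-zero m)
    where
    vanish : ∀ a → u a * E (res m N) a a ≡ 0
    vanish a = trans (cong (u a *_) (E≡0 (res m N) a a (N-odd ∘ ⟨a⟩+⟨a⟩≡N⇒2∣N {a} {N} 2∣m))) (ℕP.*-zeroʳ (u a))

  diagonalSum-even : ∀ {t} → m ≡ t * 2 → ∀ {N k j} → N ≡ + 2 ℤ.* k → N ℤ.+ + m ≡ + 2 ℤ.* j →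
    ∀ u → diagonalSum u (res m N) ≡ u (res m k) + u (res m j)
  diagonalSum-even {t} m≡t*2 {N} {k} {j} N≡2k N+m≡2j u =
    trans (∑-support₂ (λ a → u a * E (res m N) a a) res-k≢res-j vanish) (cong₂ _+_ (at half-k) (at half-j))
    where
    open Halves {t} m≡t*2 N≡2k N+m≡2j
    at : ∀ {a} → res m (⟨ a ⟩ ℤ.+ ⟨ a ⟩) ≡ res m N → u a * E (res m N) a a ≡ u a
    at {a} a+a≡N = trans (cong (u a *_) (E≡1 (res m N) a a a+a≡N)) (ℕP.*-identityʳ (u a))
    vanish : ∀ a → a ≢ res m k → a ≢ res m j → u a * E (res m N) a a ≡ 0
    vanish a a≢k a≢j = trans (cong (u a *_) (E≡0 (res m N) a a (Sum.[ a≢k , a≢j ] ∘ only-halves a)))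
                             (ℕP.*-zeroʳ (u a))

  ⋆-1 : ∀ u N → (u ⋆ one) (res m N) ≡ sum u
  ⋆-1 u N = trans (fiberSum-at (λ a _ → u a * 1) N) (sum-cong-≗ {m} (λ a → ℕP.*-identityʳ (u a)))

  fiberSum-+₅ : ∀ (K₁ K₂ K₃ K₄ K₅ : Fin m → Fin m → ℕ) n →
    fiberSum (λ a b → K₁ a b + K₂ a b + K₃ a b + K₄ a b + K₅ a b) n
      ≡ fiberSum K₁ n + fiberSum K₂ n + fiberSum K₃ n + fiberSum K₄ n + fiberSum K₅ n
  fiberSum-+₅ K₁ K₂ K₃ K₄ K₅ n =
    trans (fiberSum-+ (λ a b → K₁ a b + K₂ a b + K₃ a b + K₄ a b) K₅ n) (cong (_+ fiberSum K₅ n)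
    (trans (fiberSum-+ (λ a b → K₁ a b + K₂ a b + K₃ a b) K₄ n) (cong (_+ fiberSum K₄ n)
    (trans (fiberSum-+ (λ a b → K₁ a b + K₂ a b) K₃ n) (cong (_+ fiberSum K₃ n)
    (fiberSum-+ K₁ K₂ n))))))

  ⋆-cross : ∀ x y c → (∀ a → x a + y a ≡ 1 + c a) → ∀ n →
    (y ⋆ y) n + (x ⋆ one) n + (one ⋆ x) n + (c ⋆ x) n + (x ⋆ c) n
      ≡ (x ⋆ x) n + (one ⋆ one) n + (c ⋆ one) n + (one ⋆ c) n + (c ⋆ c) n
  ⋆-cross x y c x+y≡1+c n = trans
    (sym (fiberSum-+₅ (λ a b → y a * y b) (λ a b → x a * 1) (λ a b → 1 * x b) (λ a b → c a * x b) (λ a b → x a * c b) n))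
    (trans (fiberSum-cong (λ a b → cross-identity (x a) (y a) (c a) (x b) (y b) (c b) (x+y≡1+c a) (x+y≡1+c b)) n)
           (fiberSum-+₅ (λ a b → x a * x b) (λ a b → 1 * 1) (λ a b → c a * 1) (λ a b → 1 * c b) (λ a b → c a * c b) n))

  R≡fiberSum-ordered : ∀ S n → R m S n ≡ fiberSum (λ a b → 𝟙ˢ S a * 𝟙ˢ S b * ordered a b) n
  R≡fiberSum-ordered S n = begin
    R m S n
      ≡⟨ length-filter-cartesianProduct _ {m} {m} id id ⟩
    ∑[ a < m ] ∑[ b < m ] 𝟙 ((a ∈? S ×-dec b ∈? S) ×-dec (toℕ a ℕ.≤? toℕ b ×-dec sums? n a b))
      ≡⟨ sum-cong-≗ {m} (λ a → sum-cong-≗ {m} (λ b → pair-test a b)) ⟩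
    fiberSum (λ a b → 𝟙ˢ S a * 𝟙ˢ S b * ordered a b) n ∎
    where
    open ≡-Reasoning
    pair-test : ∀ a b → 𝟙 ((a ∈? S ×-dec b ∈? S) ×-dec (toℕ a ℕ.≤? toℕ b ×-dec sums? n a b))
                      ≡ 𝟙ˢ S a * 𝟙ˢ S b * ordered a b * E n a b
    pair-test a b = trans (𝟙-×-dec (a ∈? S ×-dec b ∈? S) (toℕ a ℕ.≤? toℕ b ×-dec sums? n a b))
      (trans (cong₂ _*_ (𝟙-×-dec (a ∈? S) (b ∈? S)) (𝟙-×-dec (toℕ a ℕ.≤? toℕ b) (sums? n a b)))
             (sym (ℕP.*-assoc (𝟙ˢ S a * 𝟙ˢ S b) (ordered a b) (E n a b))))

  R+R : ∀ S n → R m S n + R m S n ≡ (𝟙ˢ S ⋆ 𝟙ˢ S) n + diagonalSum (𝟙ˢ S) n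
  R+R S n = begin
    R m S n + R m S n
      ≡⟨ cong₂ _+_ (R≡fiberSum-ordered S n) (R≡fiberSum-ordered S n) ⟩
    fiberSum (λ a b → 𝟙ˢ S a * 𝟙ˢ S b * ordered a b) n + fiberSum (λ a b → 𝟙ˢ S a * 𝟙ˢ S b * ordered a b) n
      ≡⟨ fiberSum-ordered-double (λ a b → 𝟙ˢ S a * 𝟙ˢ S b) (λ a b → ℕP.*-comm (𝟙ˢ S a) (𝟙ˢ S b)) n ⟩
    (𝟙ˢ S ⋆ 𝟙ˢ S) n + diagonalSum (λ a → 𝟙ˢ S a * 𝟙ˢ S a) n
      ≡⟨ cong (_+_ ((𝟙ˢ S ⋆ 𝟙ˢ S) n)) (sum-cong-≗ {m} (λ a → cong (_* E n a a) (𝟙-idem (a ∈? S)))) ⟩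
    (𝟙ˢ S ⋆ 𝟙ˢ S) n + diagonalSum (𝟙ˢ S) n ∎
    where open ≡-Reasoning

  ∑-R+R : ∀ S → ∑[ n < m ] (R m S n + R m S n) ≡ sum (𝟙ˢ S) * sum (𝟙ˢ S) + sum (𝟙ˢ S)
  ∑-R+R S = begin
    ∑[ n < m ] (R m S n + R m S n)
      ≡⟨ sum-cong-≗ {m} (R+R S) ⟩
    ∑[ n < m ] ((𝟙ˢ S ⋆ 𝟙ˢ S) n + diagonalSum (𝟙ˢ S) n)
      ≡⟨ ∑-distrib-+ (𝟙ˢ S ⋆ 𝟙ˢ S) (diagonalSum (𝟙ˢ S)) ⟩
    ∑[ n < m ] (𝟙ˢ S ⋆ 𝟙ˢ S) n + ∑[ n < m ] diagonalSum (𝟙ˢ S) n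
      ≡⟨ cong₂ _+_ (trans (∑-fiberSum (λ a b → 𝟙ˢ S a * 𝟙ˢ S b)) (∑∑-* (𝟙ˢ S) (𝟙ˢ S)))
                   (∑-diagonalSum (𝟙ˢ S)) ⟩
    sum (𝟙ˢ S) * sum (𝟙ˢ S) + sum (𝟙ˢ S) ∎
    where open ≡-Reasoning

  -- Summing R_S over ℤ_m gives (|S|² + |S|)/2, which determines |S|.
  R≗⇒∑𝟙ˢ≡ : ∀ {S T} → (∀ n → R m S n ≡ R m T n) → sum (𝟙ˢ S) ≡ sum (𝟙ˢ T)
  R≗⇒∑𝟙ˢ≡ {S} {T} R≗ = strictlyMonotone⇒injective (λ s → s * s + s)
    (λ s<s′ → ℕP.+-mono-< (ℕP.*-mono-< s<s′ s<s′) s<s′)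
    (trans (sym (∑-R+R S)) (trans (sum-cong-≗ {m} (λ n → cong₂ _+_ (R≗ n) (R≗ n))) (∑-R+R T)))

module Cover (m : ℕ) .{{_ : NonZero m}} {A B : Subset m} {r₁ r₂ : Fin m} (r₁≢r₂ : r₁ ≢ r₂)
             (A∪B≡⊤ : A ∪ B ≡ ⊤) (A∩B≡C : A ∩ B ≡ ⁅ r₁ ⁆ ∪ ⁅ r₂ ⁆)
             (R≗ : ∀ n → R m A n ≡ R m B n) where

  open Residues m
  open Convolution m

  C : Subset m
  C = ⁅ r₁ ⁆ ∪ ⁅ r₂ ⁆

  x y c : Fin m → ℕ
  x = 𝟙ˢ A
  y = 𝟙ˢ B
  c = 𝟙ˢ C

  x+y≡1+c : ∀ a → x a + y a ≡ 1 + c a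
  x+y≡1+c = 𝟙ˢ-∪-∩ A∪B≡⊤ A∩B≡C

  ∣A∣+∣B∣≡m+2 : sum x + sum y ≡ m + 2
  ∣A∣+∣B∣≡m+2 = begin
    sum x + sum y          ≡⟨ sym (∑-distrib-+ x y) ⟩
    ∑[ a < m ] (x a + y a) ≡⟨ sum-cong-≗ {m} x+y≡1+c ⟩
    ∑[ a < m ] (1 + c a)   ≡⟨ ∑-distrib-+ one c ⟩
    sum one + sum c        ≡⟨ cong₂ _+_ (∑-1 m) (trans (sum-cong-≗ {m} (λ a → sym (ℕP.*-identityʳ (c a))))
                                                     (∑-𝟙ˢ-pair r₁≢r₂ one)) ⟩
    m + 2                  ∎
    where open ≡-Reasoning

  ∣A∣+∣A∣≡m+2 : sum x + sum x ≡ m + 2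
  ∣A∣+∣A∣≡m+2 = trans (cong (_+_ (sum x)) (R≗⇒∑𝟙ˢ≡ R≗)) ∣A∣+∣B∣≡m+2

  c⋆ : ∀ u N → (c ⋆ u) (res m N) ≡ u (res m (N - ⟨ r₁ ⟩)) + u (res m (N - ⟨ r₂ ⟩))
  c⋆ u N = trans (fiberSum-at (λ a b → c a * u b) N) (∑-𝟙ˢ-pair r₁≢r₂ (λ a → u (res m (N - ⟨ a ⟩))))

  T : ℤ → ℕ
  T N = χ m A (N - ⟨ r₁ ⟩) + χ m A (N - ⟨ r₂ ⟩)

  c⋆x≡T : ∀ N → (c ⋆ x) (res m N) ≡ T N
  c⋆x≡T N = trans (c⋆ x N) (sym (cong₂ _+_ (χ≡𝟙ˢ m A (N - ⟨ r₁ ⟩)) (χ≡𝟙ˢ m A (N - ⟨ r₂ ⟩))))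

  y⋆y+2T≡x⋆x+2+c⋆c : ∀ N →
    (y ⋆ y) (res m N) + (T N + T N) ≡ (x ⋆ x) (res m N) + 2 + (c ⋆ c) (res m N)
  y⋆y+2T≡x⋆x+2+c⋆c N = ℕP.+-cancelˡ-≡ (m + 2) _ _ (begin
    (m + 2) + ((y ⋆ y) n + (T N + T N))
      ≡⟨ cong (_+ ((y ⋆ y) n + (T N + T N))) (sym ∣A∣+∣A∣≡m+2) ⟩
    (sum x + sum x) + ((y ⋆ y) n + (T N + T N))
      ≡⟨ shuffle₁ (sum x) ((y ⋆ y) n) (T N) ⟩
    (y ⋆ y) n + sum x + sum x + T N + T N
      ≡⟨ sym (cong₂ _+_ (cong₂ _+_ (cong₂ _+_ (cong (_+_ ((y ⋆ y) n)) (⋆-1 x N)) (trans (⋆-comm one x n) (⋆-1 x N)))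
                                  (c⋆x≡T N))
                        (trans (⋆-comm x c n) (c⋆x≡T N))) ⟩
    (y ⋆ y) n + (x ⋆ one) n + (one ⋆ x) n + (c ⋆ x) n + (x ⋆ c) n
      ≡⟨ ⋆-cross x y c x+y≡1+c n ⟩
    (x ⋆ x) n + (one ⋆ one) n + (c ⋆ one) n + (one ⋆ c) n + (c ⋆ c) n
      ≡⟨ cong (_+ (c ⋆ c) n) (cong₂ _+_ (cong₂ _+_ (cong (_+_ ((x ⋆ x) n)) (trans (⋆-1 one N) (∑-1 m))) (c⋆ one N))
                                        (trans (⋆-comm one c n) (c⋆ one N))) ⟩
    (x ⋆ x) n + m + 2 + 2 + (c ⋆ c) n
      ≡⟨ shuffle₂ ((x ⋆ x) n) m ((c ⋆ c) n) ⟩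
    (m + 2) + ((x ⋆ x) n + 2 + (c ⋆ c) n) ∎)
    where
    open ≡-Reasoning
    n : Fin m
    n = res m N
    shuffle₁ : ∀ s o t → (s + s) + (o + (t + t)) ≡ o + s + s + t + t
    shuffle₁ = solve-∀
    shuffle₂ : ∀ o m o′ → o + m + 2 + 2 + o′ ≡ (m + 2) + (o + 2 + o′)
    shuffle₂ = solve-∀

  diagonalSum-split : ∀ n → diagonalSum x n + diagonalSum y n ≡ diagonalSum one n + diagonalSum c n
  diagonalSum-split n = begin
    diagonalSum x n + diagonalSum y n                   ≡⟨ sym (∑-distrib-+ (λ a → x a * E n a a) (λ a → y a * E n a a)) ⟩
    ∑[ a < m ] (x a * E n a a + y a * E n a a)           ≡⟨ sum-cong-≗ {m} split ⟩
    ∑[ a < m ] (1 * E n a a + c a * E n a a)             ≡⟨ ∑-distrib-+ (λ a → 1 * E n a a) (λ a → c a * E n a a) ⟩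
    diagonalSum one n + diagonalSum c n                 ∎
    where
    open ≡-Reasoning
    split : ∀ a → x a * E n a a + y a * E n a a ≡ 1 * E n a a + c a * E n a a
    split a = trans (sym (ℕP.*-distribʳ-+ (E n a a) (x a) (y a)))
                    (trans (cong (_* E n a a) (x+y≡1+c a)) (ℕP.*-distribʳ-+ (E n a a) 1 (c a)))

  T+Dₓ-doubled : ∀ N →
    (T N + diagonalSum x (res m N)) + (T N + diagonalSum x (res m N))
      ≡ 2 + diagonalSum one (res m N) + (R m C (res m N) + R m C (res m N))
  T+Dₓ-doubled N = eliminate-squares
    {oA = (x ⋆ x) n} {(y ⋆ y) n} {(c ⋆ c) n} {diagonalSum x n} {diagonalSum y n} {diagonalSum c n} {diagonalSum one n}
    {R m A n} {R m C n} {T N} (y⋆y+2T≡x⋆x+2+c⋆c N)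
    (R+R A n) (trans (cong₂ _+_ (R≗ n) (R≗ n)) (R+R B n)) (R+R C n) (diagonalSum-split n)
    where
    n : Fin m
    n = res m N

  T-odd : 2 ∣ m → ∀ N → ¬ (+ 2 ∣ℤ N) → T N ≡ 1 + R m C (res m N)
  T-odd 2∣m N N-odd = +-double-injective (begin
    T N + T N
      ≡⟨ sym (cong₂ _+_ (ℕP.+-identityʳ (T N)) (ℕP.+-identityʳ (T N))) ⟩
    (T N + 0) + (T N + 0)
      ≡⟨ sym (cong (λ d → (T N + d) + (T N + d)) (diagonalSum-odd N 2∣m N-odd x)) ⟩
    (T N + diagonalSum x n) + (T N + diagonalSum x n)
      ≡⟨ T+Dₓ-doubled N ⟩
    2 + diagonalSum one n + (R m C n + R m C n)
      ≡⟨ cong (λ d → 2 + d + (R m C n + R m C n)) (diagonalSum-odd N 2∣m N-odd one) ⟩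
    2 + (R m C n + R m C n)
      ≡⟨ regroup (R m C n) ⟩
    (1 + R m C n) + (1 + R m C n) ∎)
    where
    open ≡-Reasoning
    n : Fin m
    n = res m N
    regroup : ∀ r → 2 + (r + r) ≡ (1 + r) + (1 + r)
    regroup = solve-∀

  T-even : ∀ {t} → m ≡ t * 2 → ∀ N k j → N ≡ + 2 ℤ.* k → N ℤ.+ + m ≡ + 2 ℤ.* j →
    T N + χ m A k + χ m A j ≡ 2 + R m C (res m N)
  T-even {t} m≡t*2 N k j N≡2k N+m≡2j = begin
    T N + χ m A k + χ m A j
      ≡⟨ ℕP.+-assoc (T N) (χ m A k) (χ m A j) ⟩
    T N + (χ m A k + χ m A j)
      ≡⟨ cong (_+_ (T N)) (trans (cong₂ _+_ (χ≡𝟙ˢ m A k) (χ≡𝟙ˢ m A j)) (sym (diagonal x))) ⟩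
    T N + diagonalSum x n
      ≡⟨ +-double-injective (trans (T+Dₓ-doubled N) (trans (cong (λ d → 2 + d + (R m C n + R m C n)) (diagonal one))
                                                              (regroup (R m C n)))) ⟩
    2 + R m C n ∎
    where
    open ≡-Reasoning
    n : Fin m
    n = res m N
    diagonal : ∀ u → diagonalSum u n ≡ u (res m k) + u (res m j)
    diagonal = diagonalSum-even {t} m≡t*2 N≡2k N+m≡2j
    regroup : ∀ r → 2 + 2 + (r + r) ≡ (2 + r) + (2 + r)
    regroup = solve-∀

lemma2 : (m : ℕ) .{{_ : NonZero m}} → 2 ∣ m →
    (A B : Subset m) (r₁ r₂ : Fin m) → r₁ ≢ r₂ →
    A ∪ B ≡ ⊤ → A ∩ B ≡ ⁅ r₁ ⁆ ∪ ⁅ r₂ ⁆ →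
    (∀ (n : Fin m) → R m A n ≡ R m B n) →
    ((n : ℤ) → ¬ (+ 2 ∣ℤ n) →
       χ m A (n - + toℕ r₁) + χ m A (n - + toℕ r₂)
         ≡ 1 + R m (⁅ r₁ ⁆ ∪ ⁅ r₂ ⁆) (res m n))
    ×
    ((n k j : ℤ) → n ≡ + 2 ℤ.* k → n ℤ.+ + m ≡ + 2 ℤ.* j →
       χ m A (n - + toℕ r₁) + χ m A (n - + toℕ r₂) + χ m A k + χ m A j
         ≡ 2 + R m (⁅ r₁ ⁆ ∪ ⁅ r₂ ⁆) (res m n))
lemma2 m 2∣m@(ℕ∣.divides t m≡t*2) A B r₁ r₂ r₁≢r₂ A∪B≡⊤ A∩B≡C R≗ = T-odd 2∣m , T-even {t} m≡t*2
  where open Cover m r₁≢r₂ A∪B≡⊤ A∩B≡C R≗
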